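{- Let $t>u\ge 1$ be integers. Then there exists a bijection $\alpha:[t]\to[t]$ with the property that, for every $a\in[t]$, if $\alpha(a)\le t-u-1$ then $a+1\in[t]$ and $\alpha(a+1)=\alpha(a)+u$.
   Context: For an integer $N$, $[N]=\{0,1,\dots,N-1\}$. -}

-- Read α as the sequence α(0), α(1), …, α(t-1). The condition says the sequence is a
-- concatenation of maximal arithmetic progressions of step u. Such a sequence is built by
-- induction on t: for t ≤ u the condition is vacuous, and for t ≥ u inserting the new
-- value t directly after the position holding t - u extends that progression by one term
-- and leaves the others intact.
module Submission where

open import Data.Fin using (Fin; zero; suc; toℕ; fromℕ; fromℕ<; inject₁; punchIn; punchOut; _≟_)
open import Data.Fin.Permutation using (Permutation′; _⟨$⟩ʳ_; _⟨$⟩ˡ_; id; insert; insert-punchIn; inverseʳ)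
open import Data.Fin.Properties using (toℕ-injective; toℕ<n; toℕ-fromℕ; toℕ-fromℕ<; toℕ-inject₁; punchIn-punchOut)
open import Data.Nat using (ℕ; zero; suc; _+_; _∸_; _≤_; _<_; z≤n; s≤s; s≤s⁻¹; _≤?_)
open import Data.Nat.Properties using (suc-injective; <⇒≱; ≤-<-trans; <-irrefl; ≰⇒>; m≤n+m; m+1+n≰m; +-suc; +-comm; +-cancelʳ-≡; m≤n⇒m<n∨m≡n; ∸-monoʳ-<; ∸-+-assoc; m∸n+n≡m; m≤o∸n⇒m+n≤o)
open import Data.Product using (Σ; ∃; _×_; _,_)
open import Data.Sum using (_⊎_; inj₁; inj₂)
open import Function using (_∘_; Injection)
open import Function.Properties.Inverse using (↔⇒↣)
open import Relation.Binary.PropositionalEquality using (_≡_; _≢_; refl; sym; trans; cong; subst; module ≡-Reasoning)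
open import Relation.Nullary using (yes; no; contradiction)

m≤o∸n∸1⇒m+n<o : ∀ m {n o} → n < o → m ≤ o ∸ n ∸ 1 → m + n < o
m≤o∸n∸1⇒m+n<o m {n} {o} n<o m≤o∸n∸1 =
  subst (_≤ o) (+-suc m n) (m≤o∸n⇒m+n≤o m n<o (subst (m ≤_) o∸n∸1≡o∸[1+n] m≤o∸n∸1))
  where
  o∸n∸1≡o∸[1+n] : o ∸ n ∸ 1 ≡ o ∸ suc n
  o∸n∸1≡o∸[1+n] = trans (∸-+-assoc o n 1) (cong (o ∸_) (+-comm n 1))

punchIn-or-self : ∀ {n} (i j : Fin (suc n)) → i ≡ j ⊎ ∃ λ k → punchIn i k ≡ j
punchIn-or-self i j with i ≟ j
... | yes i≡j = inj₁ i≡j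
... | no i≢j = inj₂ (punchOut i≢j , punchIn-punchOut i≢j)

punchIn-fromℕ : ∀ {n} (k : Fin n) → punchIn (fromℕ n) k ≡ inject₁ k
punchIn-fromℕ zero = refl
punchIn-fromℕ (suc k) = cong suc (punchIn-fromℕ k)

punchIn-suc-self : ∀ {n} (k : Fin n) → punchIn (suc k) k ≡ inject₁ k
punchIn-suc-self zero = refl
punchIn-suc-self (suc k) = cong suc (punchIn-suc-self k)

toℕ-punchIn-consecutive : ∀ {n} (i : Fin (suc n)) {k k′ : Fin n} →
  toℕ k′ ≡ suc (toℕ k) → toℕ i ≢ toℕ k′ → toℕ (punchIn i k′) ≡ suc (toℕ (punchIn i k))
toℕ-punchIn-consecutive zero k′≡1+k _ = cong suc k′≡1+k
toℕ-punchIn-consecutive (suc zero) {zero} {suc zero} refl 1≢1 = contradiction refl 1≢1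
toℕ-punchIn-consecutive (suc (suc i)) {zero} {suc zero} refl _ = refl
toℕ-punchIn-consecutive (suc i) {suc k} {suc k′} 1+k′≡2+k i≢k′ =
  cong suc (toℕ-punchIn-consecutive i (suc-injective 1+k′≡2+k) (i≢k′ ∘ cong suc))

insert-self : ∀ {m} (i j : Fin (suc m)) (π : Permutation′ m) → insert i j π ⟨$⟩ʳ i ≡ j
insert-self i j π with i ≟ i
... | yes _ = refl
... | no i≢i = contradiction refl i≢i

toℕ-insert-fromℕ-punchIn : ∀ {n} (i : Fin (suc n)) (π : Permutation′ n) (k : Fin n) →
  toℕ (insert i (fromℕ n) π ⟨$⟩ʳ punchIn i k) ≡ toℕ (π ⟨$⟩ʳ k)
toℕ-insert-fromℕ-punchIn {n} i π k = begin
  toℕ (insert i (fromℕ n) π ⟨$⟩ʳ punchIn i k)  ≡⟨ cong toℕ (insert-punchIn i (fromℕ n) π k) ⟩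
  toℕ (punchIn (fromℕ n) (π ⟨$⟩ʳ k))           ≡⟨ cong toℕ (punchIn-fromℕ (π ⟨$⟩ʳ k)) ⟩
  toℕ (inject₁ (π ⟨$⟩ʳ k))                      ≡⟨ toℕ-inject₁ (π ⟨$⟩ʳ k) ⟩
  toℕ (π ⟨$⟩ʳ k)                                ∎
  where open ≡-Reasoning

Chained : (u : ℕ) {t : ℕ} → Permutation′ t → Set
Chained u {t} α = (a : Fin t) → toℕ (α ⟨$⟩ʳ a) + u < t →
  ∃ λ b → toℕ b ≡ suc (toℕ a) × toℕ (α ⟨$⟩ʳ b) ≡ toℕ (α ⟨$⟩ʳ a) + u

chained-short : ∀ {u t} → t ≤ u → (α : Permutation′ t) → Chained u α
chained-short {u} t≤u α a αa+u<t = contradiction t≤u (<⇒≱ (≤-<-trans (m≤n+m u (toℕ (α ⟨$⟩ʳ a))) αa+u<t))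

chained-fromℕ< : ∀ {u t} (α : Permutation′ t) → Chained u α → (a : Fin t) → toℕ (α ⟨$⟩ʳ a) + u < t →
  Σ (suc (toℕ a) < t) λ h → toℕ (α ⟨$⟩ʳ fromℕ< h) ≡ toℕ (α ⟨$⟩ʳ a) + u
chained-fromℕ< {t = t} α α-chained a αa+u<t with α-chained a αa+u<t
... | b , b≡1+a , αb≡αa+u = 1+a<t , trans (cong (λ i → toℕ (α ⟨$⟩ʳ i)) fromℕ<-1+a≡b) αb≡αa+u
  where
  1+a<t : suc (toℕ a) < t
  1+a<t = subst (_< t) b≡1+a (toℕ<n b)
  fromℕ<-1+a≡b : fromℕ< 1+a<t ≡ b
  fromℕ<-1+a≡b = toℕ-injective (trans (toℕ-fromℕ< 1+a<t) (sym b≡1+a))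

chained-insert : ∀ {u t} → 1 ≤ u → (α : Permutation′ t) (p : Fin t) → toℕ (α ⟨$⟩ʳ p) + u ≡ t →
  Chained u α → Chained u (insert (suc p) (fromℕ t) α)
chained-insert {suc v} {t} (s≤s z≤n) α p αp+u≡t chained = α⁺-chained
  where
  open ≡-Reasoning

  u : ℕ
  u = suc v

  α⁺ : Permutation′ (suc t)
  α⁺ = insert (suc p) (fromℕ t) α

  α⁺-new : toℕ (α⁺ ⟨$⟩ʳ suc p) ≡ t
  α⁺-new = trans (cong toℕ (insert-self (suc p) (fromℕ t) α)) (toℕ-fromℕ t)

  α⁺-punchIn : ∀ k → toℕ (α⁺ ⟨$⟩ʳ punchIn (suc p) k) ≡ toℕ (α ⟨$⟩ʳ k)
  α⁺-punchIn = toℕ-insert-fromℕ-punchIn (suc p) α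

  only-p-reaches-t : ∀ k → toℕ (α ⟨$⟩ʳ k) + u ≡ t → k ≡ p
  only-p-reaches-t k αk+u≡t =
    Injection.injective (↔⇒↣ α) (toℕ-injective (+-cancelʳ-≡ u _ _ (trans αk+u≡t (sym αp+u≡t))))

  after-p : ∃ λ b →
    toℕ b ≡ suc (toℕ (punchIn (suc p) p)) × toℕ (α⁺ ⟨$⟩ʳ b) ≡ toℕ (α⁺ ⟨$⟩ʳ punchIn (suc p) p) + u
  after-p = suc p , cong suc (sym p-stays) , (begin
    toℕ (α⁺ ⟨$⟩ʳ suc p)                   ≡⟨ α⁺-new ⟩
    t                                      ≡⟨ sym αp+u≡t ⟩
    toℕ (α ⟨$⟩ʳ p) + u                    ≡⟨ cong (_+ u) (sym (α⁺-punchIn p)) ⟩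
    toℕ (α⁺ ⟨$⟩ʳ punchIn (suc p) p) + u   ∎)
    where
    p-stays : toℕ (punchIn (suc p) p) ≡ toℕ p
    p-stays = trans (cong toℕ (punchIn-suc-self p)) (toℕ-inject₁ p)

  after-punchIn : ∀ k → toℕ (α ⟨$⟩ʳ k) + u < suc t → ∃ λ b →
    toℕ b ≡ suc (toℕ (punchIn (suc p) k)) × toℕ (α⁺ ⟨$⟩ʳ b) ≡ toℕ (α⁺ ⟨$⟩ʳ punchIn (suc p) k) + u
  after-punchIn k αk+u<1+t with m≤n⇒m<n∨m≡n (s≤s⁻¹ αk+u<1+t)
  ... | inj₂ αk+u≡t rewrite only-p-reaches-t k αk+u≡t = after-p
  ... | inj₁ αk+u<t with chained k αk+u<t
  ...   | k′ , k′≡1+k , αk′≡αk+u =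
    punchIn (suc p) k′ , toℕ-punchIn-consecutive (suc p) k′≡1+k 1+p≢k′ , (begin
    toℕ (α⁺ ⟨$⟩ʳ punchIn (suc p) k′)      ≡⟨ α⁺-punchIn k′ ⟩
    toℕ (α ⟨$⟩ʳ k′)                       ≡⟨ αk′≡αk+u ⟩
    toℕ (α ⟨$⟩ʳ k) + u                    ≡⟨ cong (_+ u) (sym (α⁺-punchIn k)) ⟩
    toℕ (α⁺ ⟨$⟩ʳ punchIn (suc p) k) + u   ∎)
    where
    1+p≢k′ : suc (toℕ p) ≢ toℕ k′
    1+p≢k′ 1+p≡k′ = <-irrefl (subst (λ i → toℕ (α ⟨$⟩ʳ i) + u ≡ t) p≡k αp+u≡t) αk+u<t
      where
      p≡k : p ≡ k
      p≡k = toℕ-injective (suc-injective (trans 1+p≡k′ k′≡1+k))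

  α⁺-chained : Chained u α⁺
  α⁺-chained a α⁺a+u<1+t with punchIn-or-self (suc p) a
  ... | inj₁ refl = contradiction (s≤s⁻¹ (subst (λ x → x + u < suc t) α⁺-new α⁺a+u<1+t)) (m+1+n≰m t)
  ... | inj₂ (k , refl) = after-punchIn k (subst (λ x → x + u < suc t) (α⁺-punchIn k) α⁺a+u<1+t)

chained-exists : ∀ {u} → 1 ≤ u → ∀ t → ∃ λ (α : Permutation′ t) → Chained u α
chained-exists u≥1 zero = id , chained-short z≤n id
chained-exists {u} u≥1 (suc t) with u ≤? t
... | no u≰t = id , chained-short (≰⇒> u≰t) id
... | yes u≤t with chained-exists u≥1 t
...   | α , α-chained = insert (suc p) (fromℕ t) α , chained-insert u≥1 α p αp+u≡t α-chained
  where
  t∸u<t : t ∸ u < t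
  t∸u<t = ∸-monoʳ-< u≥1 u≤t
  p : Fin t
  p = α ⟨$⟩ˡ fromℕ< t∸u<t
  αp+u≡t : toℕ (α ⟨$⟩ʳ p) + u ≡ t
  αp+u≡t = begin
    toℕ (α ⟨$⟩ʳ p) + u          ≡⟨ cong (λ i → toℕ i + u) (inverseʳ α) ⟩
    toℕ (fromℕ< t∸u<t) + u      ≡⟨ cong (_+ u) (toℕ-fromℕ< t∸u<t) ⟩
    t ∸ u + u                   ≡⟨ m∸n+n≡m u≤t ⟩
    t                           ∎
    where open ≡-Reasoning

lemma14 : (t u : ℕ) → 1 ≤ u → u < t →
    ∃ λ (α : Permutation′ t) →
      (a : Fin t) → toℕ (α ⟨$⟩ʳ a) ≤ t ∸ u ∸ 1 →
        Σ (suc (toℕ a) < t) λ h →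
          toℕ (α ⟨$⟩ʳ fromℕ< h) ≡ toℕ (α ⟨$⟩ʳ a) + u
lemma14 t u u≥1 u<t with chained-exists u≥1 t
... | α , α-chained = α , λ a αa≤t∸u∸1 → chained-fromℕ< α α-chained a (m≤o∸n∸1⇒m+n<o _ u<t αa≤t∸u∸1)
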